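{- Let $d\ge1$ and $r=\lceil 32e\rceil$. There exists an $rd$-dimensional abstract spindle $G'$ on a symbol set of size $2rd$ whose length is at least $\binom{2d}{d}-1$ (in particular exponential in $d$), and which satisfies the strong adjacency and end-point count properties.
   Context: Let $S$ be a finite set of symbols, $n=|S|$, $1\le d\le n$, and $\mathcal A\subseteq\binom{S}{d}$. A $d$-dimensional subset partition graph (SPG) of $\mathcal A$ on $S$ is a connected undirected graph $G=(\mathcal V,E)$ whose vertex set $\mathcal V$ is a partition of $\mathcal A$ into non-empty parts. An abstract spindle is such an SPG with $n=2d$ together with two distinguished apices $A_1,A_2\in\mathcal A$ with $A_1\cup A_2=S$; its length is the graph distance in $G$ between the vertices containing $A_1$ and $A_2$. $G$ satisfies adjacency if whenever $A,A'\in\mathcal A$ with $|A\cap A'|=d-1$, $A$ and $A'$ lie in the same or adjacent vertices; strong adjacency if it satisfies adjacency and for every pair of adjacent vertices $V,V'$ there are $A\in V$, $A'\in V'$ with $|A\cap A'|=d-1$; end-point count if for every $F\in\binom{S}{d-1}$ at most two $A\in\mathcal A$ contain $F$. -}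

module Defs where

open import Data.Nat using (ℕ; zero; suc; _∸_; _≤_)
open import Data.Fin using (Fin)
open import Data.Fin.Subset using (Subset; ∣_∣; _∩_; _∪_; _⊆_; ⊤)
open import Data.Maybe using (Maybe; just)
open import Data.Product using (Σ; ∃; _×_; ∃-syntax)
open import Data.Sum using (_⊎_)
open import Relation.Binary.PropositionalEquality using (_≡_)
open import Relation.Nullary using (¬_)

-- r = ⌈32e⌉.  Since 86/32 = 2.6875 < e < 2.71875 = 87/32, we have ⌈32e⌉ = 87.
r : ℕ
r = 87

data Walk {k : ℕ} (E : Fin k → Fin k → Set) : Fin k → Fin k → ℕ → Set where
  here : ∀ {u} → Walk E u u 0
  step : ∀ {u w v ℓ} → E u w → Walk E w v ℓ → Walk E u v (suc ℓ)

-- A d-dimensional subset partition graph on the symbol set S = Fin n.  The map `vtx` sends a subset A of S to `just v` iff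
-- A ∈ 𝒜 and A belongs to the part (vertex) v; otherwise `nothing`.
-- Thus the parts vtx⁻¹(v) form a partition of 𝒜 = dom(vtx).
record SPG (n d : ℕ) : Set₁ where
  field
    k       : ℕ
    vtx     : Subset n → Maybe (Fin k)
    E       : Fin k → Fin k → Set
    size    : ∀ A v → vtx A ≡ just v → ∣ A ∣ ≡ d
    nonempty : ∀ v → ∃[ A ] vtx A ≡ just v
    E-sym   : ∀ u v → E u v → E v u
    E-irr   : ∀ u → ¬ E u u
    connected : ∀ u v → ∃[ ℓ ] Walk E u v ℓ

  In𝒜 : Subset n → Set
  In𝒜 A = ∃[ v ] vtx A ≡ just v

  Adjacency : Set
  Adjacency = ∀ A A' u u' → vtx A ≡ just u → vtx A' ≡ just u' →
              ∣ A ∩ A' ∣ ≡ d ∸ 1 → (u ≡ u') ⊎ E u u'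

  StrongAdjacency : Set
  StrongAdjacency = Adjacency ×
    (∀ u u' → E u u' → ∃[ A ] ∃[ A' ]
       (vtx A ≡ just u × vtx A' ≡ just u' × ∣ A ∩ A' ∣ ≡ d ∸ 1))

  EndPointCount : Set
  EndPointCount = ∀ (F A₁ A₂ A₃ : Subset n) → ∣ F ∣ ≡ d ∸ 1 →
    In𝒜 A₁ → In𝒜 A₂ → In𝒜 A₃ → F ⊆ A₁ → F ⊆ A₂ → F ⊆ A₃ →
    (A₁ ≡ A₂) ⊎ (A₁ ≡ A₃) ⊎ (A₂ ≡ A₃)

record Spindle (d : ℕ) : Set₁ where
  field
    G    : SPG (d Data.Nat.+ d) d
    A₁   : Subset (d Data.Nat.+ d)
    A₂   : Subset (d Data.Nat.+ d)
    v₁   : Fin (SPG.k G)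
    v₂   : Fin (SPG.k G)
    A₁∈  : SPG.vtx G A₁ ≡ just v₁
    A₂∈  : SPG.vtx G A₂ ≡ just v₂
    cover : A₁ ∪ A₂ ≡ ⊤

  LengthAtLeast : ℕ → Set
  LengthAtLeast L = ∀ ℓ → Walk (SPG.E G) v₁ v₂ ℓ → L ≤ ℓ

module Submission where

-- Split rd symbols into a flag block of size 1 and 2d blocks of sizes ≥ 2, and
-- take two copies of them as the symbol set.  A code (f, b) ∈ 𝔹 × 𝔹^{2d} picks
-- every block (the flag block for f, block i for bᵢ) in the right copy if its
-- bit is set and in the left copy otherwise; this gives an rd-set.  Two such
-- sets share rd − 1 symbols only if their bit vectors b agree, because a block
-- on which they disagree costs all of its ≥ 2 symbols.  Hence 𝒜 splits into the
-- pairs {(false, b), (true, b)}, and putting (f, b) at vertex ⟨b⟩ + f of the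
-- path 0, 1, …, 2^{2d}, where ⟨b⟩ is the binary value of b, places each pair on
-- one edge: this is strong adjacency, and three sets through a common
-- (rd − 1)-set share b, so two of them coincide.  The apices (false, 0…0) and
-- (true, 1…1) are complementary and sit at the ends of the path, at distance
-- 2^{2d} ≥ C(2d, d).

open import Defs
open import Data.Nat using (ℕ; _*_; _∸_; _≤_)
open import Data.Nat.Combinatorics using (_C_)
open import Data.Product using (Σ; _×_)

open import Data.Bool using (Bool; true; false; not; _∧_; _∨_; _xor_; if_then_else_)
  renaming (_≟_ to _≟ᵇ_)
open import Data.Fin using (Fin; zero; suc; toℕ; fromℕ<; inject₁; combine; quotient; remainder; _↑ˡ_; _↑ʳ_)
open import Data.Fin.Properties
  using (2↔Bool; toℕ-injective; toℕ-fromℕ<; toℕ<n; toℕ-inject₁; toℕ-↑ˡ; toℕ-↑ʳ; combine-remQuot)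
open import Data.Fin.Subset using (Subset; inside; outside; ∣_∣; _∩_; _∪_; _⊆_; ⊤; ⊥; ∁)
open import Data.Fin.Subset.Properties
  using (∣⊤∣≡n; ∣⊥∣≡0; ∣p∣≡n⇒p≡⊤; ∩-idem; ∩-comm; p∪∁p≡⊤; p⊆q⇒∣p∣≤∣q∣; x∈p∩q⁺; anySubset?)
open import Data.List using (List; []; _∷_; length)
open import Data.List.Relation.Unary.All as All using (All; []; _∷_)
open import Data.Maybe using (Maybe; just; nothing)
open import Data.Maybe.Properties using (just-injective)
open import Data.Nat using (suc; zero; _+_; _^_; _<_; s≤s; z≤n)
open import Data.Nat.Combinatorics using (nCk+nC[k+1]≡[n+1]C[k+1])
open import Data.Nat.ListAction using (sum)
open import Data.Nat.Properties
open import Data.Product using (_,_; ∃-syntax)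
open import Data.Sum as Sum using (_⊎_; inj₁; inj₂; [_,_]′)
open import Data.Vec using ([]; _∷_; _++_; replicate; map)
open import Data.Vec.Properties
  using (zipWith-++; zipWith-replicate; map-++; map-replicate; ∷-injectiveˡ; ∷-injectiveʳ; ++-injectiveʳ; ≡-dec)
open import Function using (Inverse; _∘_)
open import Relation.Binary.PropositionalEquality
open import Relation.Nullary using (¬_; Dec; yes; no; contradiction)

open import Algebra.Properties.CommutativeSemigroup +-commutativeSemigroup using (interchange)

-- Walks on a path

module _ {k : ℕ} {E : Fin k → Fin k → Set} where

  _▷_ : ∀ {u w v ℓ} → Walk E u w ℓ → E w v → Walk E u v (suc ℓ)
  here      ▷ e = step e here
  step e′ p ▷ e = step e′ (p ▷ e)

  reverse : (∀ u v → E u v → E v u) → ∀ {u v ℓ} → Walk E u v ℓ → Walk E v u ℓ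
  reverse sym here                = here
  reverse sym (step {u} {w} e p) = reverse sym p ▷ sym u w e

module _ {k : ℕ} where

  Consecutive : Fin k → Fin k → Set
  Consecutive u v = toℕ v ≡ suc (toℕ u) ⊎ toℕ u ≡ suc (toℕ v)

  Consecutive-sym : ∀ u v → Consecutive u v → Consecutive v u
  Consecutive-sym u v = Sum.swap

  Consecutive-irrefl : ∀ u → ¬ Consecutive u u
  Consecutive-irrefl u = [ 1+n≢n ∘ sym , 1+n≢n ∘ sym ]′

  Consecutive⇒≤1+ : ∀ {u v} → Consecutive u v → toℕ v ≤ suc (toℕ u)
  Consecutive⇒≤1+ (inj₁ v≡1+u) = ≤-reflexive v≡1+u
  Consecutive⇒≤1+ {u} {v} (inj₂ u≡1+v) =
    m≤n⇒m≤1+n (≤-trans (n≤1+n (toℕ v)) (≤-reflexive (sym u≡1+v)))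

  ascend : ∀ δ (u v : Fin k) → toℕ v ≡ δ + toℕ u → Walk Consecutive u v δ
  ascend zero    u v v≡u     = subst (λ w → Walk Consecutive u w 0) (toℕ-injective (sym v≡u)) here
  ascend (suc δ) u v v≡1+δ+u = step (inj₁ (toℕ-fromℕ< 1+u<k)) (ascend δ (fromℕ< 1+u<k) v v≡δ+[1+u])
    where
    1+u<k : suc (toℕ u) < k
    1+u<k = ≤-<-trans (s≤s (m≤n+m (toℕ u) δ)) (subst (_< k) v≡1+δ+u (toℕ<n v))
    v≡δ+[1+u] : toℕ v ≡ δ + toℕ (fromℕ< 1+u<k)
    v≡δ+[1+u] = trans v≡1+δ+u (trans (sym (+-suc δ (toℕ u))) (cong (δ +_) (sym (toℕ-fromℕ< 1+u<k))))

  Consecutive-connected : ∀ u v → ∃[ ℓ ] Walk Consecutive u v ℓ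
  Consecutive-connected u v with ≤-total (toℕ u) (toℕ v)
  ... | inj₁ u≤v = _ , ascend _ u v (sym (m∸n+n≡m u≤v))
  ... | inj₂ v≤u = _ , reverse Consecutive-sym (ascend _ v u (sym (m∸n+n≡m v≤u)))

  toℕ-walk≤ : ∀ {u v ℓ} → Walk Consecutive u v ℓ → toℕ v ≤ toℕ u + ℓ
  toℕ-walk≤ {u} here = m≤m+n (toℕ u) 0
  toℕ-walk≤ {u} {v} (step {w = w} {ℓ = ℓ} u~w p) = begin
    toℕ v           ≤⟨ toℕ-walk≤ p ⟩
    toℕ w + ℓ       ≤⟨ +-monoˡ-≤ ℓ (Consecutive⇒≤1+ u~w) ⟩
    suc (toℕ u) + ℓ ≡⟨ +-suc (toℕ u) ℓ ⟨
    toℕ u + suc ℓ   ∎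
    where open ≤-Reasoning

-- Binary indices

open Inverse 2↔Bool using () renaming (to to toBool; from to fromBool; strictlyInverseʳ to fromBool∘toBool)

index : ∀ {m} → Subset m → Fin (2 ^ m)
index []       = zero
index (b ∷ bs) = combine (fromBool b) (index bs)

bits : ∀ m → Fin (2 ^ m) → Subset m
bits zero    _ = []
bits (suc m) i = toBool (quotient {2} (2 ^ m) i) ∷ bits m (remainder {2} (2 ^ m) i)

index-bits : ∀ m (i : Fin (2 ^ m)) → index (bits m i) ≡ i
index-bits zero    zero = refl
index-bits (suc m) i = trans
  (cong₂ combine (fromBool∘toBool (quotient {2} (2 ^ m) i)) (index-bits m (remainder {2} (2 ^ m) i)))
  (combine-remQuot {2} (2 ^ m) i)

toℕ-index-⊥ : ∀ m → toℕ (index (⊥ {m})) ≡ 0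
toℕ-index-⊥ zero    = refl
toℕ-index-⊥ (suc m) = trans (toℕ-↑ˡ (index (⊥ {m})) _) (toℕ-index-⊥ m)

1+toℕ-index-⊤ : ∀ m → suc (toℕ (index (⊤ {m}))) ≡ 2 ^ m
1+toℕ-index-⊤ zero    = refl
1+toℕ-index-⊤ (suc m) = begin
  suc (toℕ (n ↑ʳ (j ↑ˡ _))) ≡⟨ cong suc (toℕ-↑ʳ n _) ⟩
  suc (n + toℕ (j ↑ˡ _))    ≡⟨ cong (λ t → suc (n + t)) (toℕ-↑ˡ j _) ⟩
  suc (n + toℕ j)           ≡⟨ +-suc n (toℕ j) ⟨
  n + suc (toℕ j)           ≡⟨ cong (n +_) (1+toℕ-index-⊤ m) ⟩
  n + n                     ≡⟨ cong (n +_) (+-identityʳ n) ⟨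
  2 ^ suc m                 ∎
  where
  open ≡-Reasoning
  n = 2 ^ m
  j = index (⊤ {m})

-- Block layouts

∣p++q∣≡∣p∣+∣q∣ : ∀ {m n} (p : Subset m) (q : Subset n) → ∣ p ++ q ∣ ≡ ∣ p ∣ + ∣ q ∣
∣p++q∣≡∣p∣+∣q∣ []            q = refl
∣p++q∣≡∣p∣+∣q∣ (inside  ∷ p) q = cong suc (∣p++q∣≡∣p∣+∣q∣ p q)
∣p++q∣≡∣p∣+∣q∣ (outside ∷ p) q = ∣p++q∣≡∣p∣+∣q∣ p q

∣p++q∩p′++q′∣ : ∀ {m n} (p p′ : Subset m) (q q′ : Subset n) →
                ∣ (p ++ q) ∩ (p′ ++ q′) ∣ ≡ ∣ p ∩ p′ ∣ + ∣ q ∩ q′ ∣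
∣p++q∩p′++q′∣ p p′ q q′ = trans (cong ∣_∣ (zipWith-++ _∧_ p q p′ q′)) (∣p++q∣≡∣p∣+∣q∣ (p ∩ p′) (q ∩ q′))

⊤++⊤≡⊤ : ∀ {m n} → ⊤ {m} ++ ⊤ {n} ≡ ⊤
⊤++⊤≡⊤ {m} {n} = ∣p∣≡n⇒p≡⊤ (trans (∣p++q∣≡∣p∣+∣q∣ (⊤ {m}) (⊤ {n})) (cong₂ _+_ (∣⊤∣≡n m) (∣⊤∣≡n n)))

∣replicate∣ : ∀ c b → ∣ replicate c b ∣ ≡ (if b then c else 0)
∣replicate∣ c false = ∣⊥∣≡0 c
∣replicate∣ c true  = ∣⊤∣≡n c

segments : (ks : List ℕ) → Subset (length ks) → Subset (sum ks)
segments []       []       = []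
segments (c ∷ ks) (b ∷ bs) = replicate c b ++ segments ks bs

layout : (ks : List ℕ) → Subset (length ks) → Subset (sum ks + sum ks)
layout ks bs = segments ks (∁ bs) ++ segments ks bs

blockAgreement : ℕ → Bool → Bool → ℕ
blockAgreement c b b′ = if b xor b′ then 0 else c

agreement : (ks : List ℕ) → Subset (length ks) → Subset (length ks) → ℕ
agreement []       []       []         = 0
agreement (c ∷ ks) (b ∷ bs) (b′ ∷ bs′) = blockAgreement c b b′ + agreement ks bs bs′

blockAgreement-self : ∀ c b → blockAgreement c b b ≡ c
blockAgreement-self c false = refl
blockAgreement-self c true  = refl

blockAgreement-≢ : ∀ c {b b′} → b ≢ b′ → blockAgreement c b b′ ≡ 0
blockAgreement-≢ c {false} {false} b≢b′ = contradiction refl b≢b′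
blockAgreement-≢ c {false} {true}  _    = refl
blockAgreement-≢ c {true}  {false} _    = refl
blockAgreement-≢ c {true}  {true}  b≢b′ = contradiction refl b≢b′

blockAgreement≤ : ∀ c b b′ → blockAgreement c b b′ ≤ c
blockAgreement≤ c false false = ≤-refl
blockAgreement≤ c false true  = z≤n
blockAgreement≤ c true  false = z≤n
blockAgreement≤ c true  true  = ≤-refl

agreement-self : ∀ ks bs → agreement ks bs bs ≡ sum ks
agreement-self []       []       = refl
agreement-self (c ∷ ks) (b ∷ bs) = cong₂ _+_ (blockAgreement-self c b) (agreement-self ks bs)

agreement≤sum : ∀ ks bs bs′ → agreement ks bs bs′ ≤ sum ks
agreement≤sum []       []       []         = z≤n
agreement≤sum (c ∷ ks) (b ∷ bs) (b′ ∷ bs′) = +-mono-≤ (blockAgreement≤ c b b′) (agreement≤sum ks bs bs′)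

∣replicate∩replicate∣ : ∀ c b b′ →
  ∣ replicate c (not b) ∩ replicate c (not b′) ∣ + ∣ replicate c b ∩ replicate c b′ ∣ ≡ blockAgreement c b b′
∣replicate∩replicate∣ c b b′ = begin
  ∣ replicate c (not b) ∩ replicate c (not b′) ∣ + ∣ replicate c b ∩ replicate c b′ ∣
    ≡⟨ cong₂ (λ x y → ∣ x ∣ + ∣ y ∣) (zipWith-replicate {n = c} _∧_ (not b) (not b′)) (zipWith-replicate {n = c} _∧_ b b′) ⟩
  ∣ replicate c (not b ∧ not b′) ∣ + ∣ replicate c (b ∧ b′) ∣
    ≡⟨ cong₂ _+_ (∣replicate∣ c (not b ∧ not b′)) (∣replicate∣ c (b ∧ b′)) ⟩
  (if not b ∧ not b′ then c else 0) + (if b ∧ b′ then c else 0)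
    ≡⟨ byCases b b′ ⟩
  blockAgreement c b b′ ∎
  where
  open ≡-Reasoning
  byCases : ∀ b b′ → (if not b ∧ not b′ then c else 0) + (if b ∧ b′ then c else 0) ≡ blockAgreement c b b′
  byCases false false = +-identityʳ c
  byCases false true  = refl
  byCases true  false = refl
  byCases true  true  = refl

∣layout∩layout∣≡agreement : ∀ ks bs bs′ → ∣ layout ks bs ∩ layout ks bs′ ∣ ≡ agreement ks bs bs′
∣layout∩layout∣≡agreement ks bs bs′ =
  trans (∣p++q∩p′++q′∣ (segments ks (∁ bs)) (segments ks (∁ bs′)) (segments ks bs) (segments ks bs′))
        (segments-agreement ks bs bs′)
  where
  segments-agreement : ∀ ks bs bs′ →
    ∣ segments ks (∁ bs) ∩ segments ks (∁ bs′) ∣ + ∣ segments ks bs ∩ segments ks bs′ ∣ ≡ agreement ks bs bs′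
  segments-agreement []       []       []         = refl
  segments-agreement (c ∷ ks) (b ∷ bs) (b′ ∷ bs′) = begin
    ∣ (rep (not b) ++ S∁) ∩ (rep (not b′) ++ S∁′) ∣ + ∣ (rep b ++ S) ∩ (rep b′ ++ S′) ∣
      ≡⟨ cong₂ _+_ (∣p++q∩p′++q′∣ (rep (not b)) (rep (not b′)) S∁ S∁′) (∣p++q∩p′++q′∣ (rep b) (rep b′) S S′) ⟩
    (∣ rep (not b) ∩ rep (not b′) ∣ + ∣ S∁ ∩ S∁′ ∣) + (∣ rep b ∩ rep b′ ∣ + ∣ S ∩ S′ ∣)
      ≡⟨ interchange (∣ rep (not b) ∩ rep (not b′) ∣) _ (∣ rep b ∩ rep b′ ∣) _ ⟩
    (∣ rep (not b) ∩ rep (not b′) ∣ + ∣ rep b ∩ rep b′ ∣) + (∣ S∁ ∩ S∁′ ∣ + ∣ S ∩ S′ ∣)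
      ≡⟨ cong₂ _+_ (∣replicate∩replicate∣ c b b′) (segments-agreement ks bs bs′) ⟩
    blockAgreement c b b′ + agreement ks bs bs′ ∎
    where
    open ≡-Reasoning
    rep : Bool → Subset c
    rep = replicate c
    S∁ = segments ks (∁ bs)
    S∁′ = segments ks (∁ bs′)
    S = segments ks bs
    S′ = segments ks bs′

∣layout∣≡sum : ∀ ks bs → ∣ layout ks bs ∣ ≡ sum ks
∣layout∣≡sum ks bs = begin
  ∣ layout ks bs ∣                    ≡⟨ cong ∣_∣ (∩-idem (layout ks bs)) ⟨
  ∣ layout ks bs ∩ layout ks bs ∣     ≡⟨ ∣layout∩layout∣≡agreement ks bs bs ⟩
  agreement ks bs bs                  ≡⟨ agreement-self ks bs ⟩
  sum ks                              ∎
  where open ≡-Reasoning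

sum≤1+agreement⇒≡ : ∀ {ks} → All (2 ≤_) ks → ∀ bs bs′ → sum ks ≤ suc (agreement ks bs bs′) → bs ≡ bs′
sum≤1+agreement⇒≡ []                 []       []         _ = refl
sum≤1+agreement⇒≡ {c ∷ ks} (c≥2 ∷ ks≥2) (b ∷ bs) (b′ ∷ bs′) h with b ≟ᵇ b′
... | yes refl = cong (b ∷_) (sum≤1+agreement⇒≡ ks≥2 bs bs′ (+-cancelˡ-≤ c _ _ (begin
  c + sum ks                                       ≤⟨ h ⟩
  suc (blockAgreement c b b + agreement ks bs bs′) ≡⟨ cong (λ x → suc (x + _)) (blockAgreement-self c b) ⟩
  suc (c + agreement ks bs bs′)                    ≡⟨ +-suc c _ ⟨
  c + suc (agreement ks bs bs′)                    ∎)))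
  where open ≤-Reasoning
... | no b≢b′ = contradiction (+-cancelʳ-≤ (sum ks) c 1 (begin
  c + sum ks                                        ≤⟨ h ⟩
  suc (blockAgreement c b b′ + agreement ks bs bs′) ≡⟨ cong (λ x → suc (x + _)) (blockAgreement-≢ c b≢b′) ⟩
  suc (agreement ks bs bs′)                         ≤⟨ s≤s (agreement≤sum ks bs bs′) ⟩
  1 + sum ks                                        ∎)) (<⇒≱ c≥2)
  where open ≤-Reasoning

segments-injective : ∀ {ks} → All (1 ≤_) ks → ∀ {bs bs′} → segments ks bs ≡ segments ks bs′ → bs ≡ bs′
segments-injective []                        {[]}     {[]}       _  = refl
segments-injective {suc c ∷ ks} (_ ∷ ks≥1) {b ∷ bs} {b′ ∷ bs′} eq =
  cong₂ _∷_ (∷-injectiveˡ eq)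
            (segments-injective ks≥1 (++-injectiveʳ (replicate c b) (replicate c b′) (∷-injectiveʳ eq)))

layout-injective : ∀ {ks} → All (1 ≤_) ks → ∀ {bs bs′} → layout ks bs ≡ layout ks bs′ → bs ≡ bs′
layout-injective {ks} ks≥1 {bs} {bs′} =
  segments-injective ks≥1 ∘ ++-injectiveʳ (segments ks (∁ bs)) (segments ks (∁ bs′))

segments-∁ : ∀ ks bs → segments ks (∁ bs) ≡ ∁ (segments ks bs)
segments-∁ []       []       = refl
segments-∁ (c ∷ ks) (b ∷ bs) = begin
  replicate c (not b) ++ segments ks (∁ bs)   ≡⟨ cong₂ _++_ (sym (map-replicate not b c)) (segments-∁ ks bs) ⟩
  map not (replicate c b) ++ ∁ (segments ks bs) ≡⟨ map-++ not (replicate c b) (segments ks bs) ⟨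
  ∁ (replicate c b ++ segments ks bs)          ∎
  where open ≡-Reasoning

layout∪layout-∁≡⊤ : ∀ ks bs → layout ks bs ∪ layout ks (∁ bs) ≡ ⊤
layout∪layout-∁≡⊤ ks bs = begin
  (∁S ++ S) ∪ (segments ks (∁ (∁ bs)) ++ ∁S) ≡⟨ zipWith-++ _∨_ ∁S S (segments ks (∁ (∁ bs))) ∁S ⟩
  (∁S ∪ segments ks (∁ (∁ bs))) ++ (S ∪ ∁S)  ≡⟨ cong₂ (λ x y → (∁S ∪ x) ++ (S ∪ y)) (segments-∁ ks (∁ bs)) (segments-∁ ks bs) ⟩
  (∁S ∪ ∁ ∁S) ++ (S ∪ ∁ S)                  ≡⟨ cong₂ _++_ (p∪∁p≡⊤ ∁S) (p∪∁p≡⊤ S) ⟩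
  ⊤ {sum ks} ++ ⊤ {sum ks}                  ≡⟨ ⊤++⊤≡⊤ {sum ks} {sum ks} ⟩
  ⊤                                         ∎
  where
  open ≡-Reasoning
  S = segments ks bs
  ∁S = segments ks (∁ bs)

-- The spindle

∣p∣≤∣q∩r∣ : ∀ {n} {p q r : Subset n} → p ⊆ q → p ⊆ r → ∣ p ∣ ≤ ∣ q ∩ r ∣
∣p∣≤∣q∩r∣ p⊆q p⊆r = p⊆q⇒∣p∣≤∣q∣ (λ x∈p → x∈p∩q⁺ (p⊆q x∈p , p⊆r x∈p))

Bool-pigeonhole : ∀ (x y z : Bool) → x ≡ y ⊎ x ≡ z ⊎ y ≡ z
Bool-pigeonhole false false _     = inj₁ refl
Bool-pigeonhole true  true  _     = inj₁ refl
Bool-pigeonhole false true  false = inj₂ (inj₁ refl)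
Bool-pigeonhole true  false true  = inj₂ (inj₁ refl)
Bool-pigeonhole false true  true  = inj₂ (inj₂ refl)
Bool-pigeonhole true  false false = inj₂ (inj₂ refl)

module CodePartition {m n k : ℕ} (encode : Subset m → Subset n)
                     (encode-injective : ∀ {c c′} → encode c ≡ encode c′ → c ≡ c′)
                     (place : Subset m → Fin k) where

  encodes? : ∀ A → Dec (∃[ c ] A ≡ encode c)
  encodes? A = anySubset? (λ c → ≡-dec _≟ᵇ_ A (encode c))

  part : Subset n → Maybe (Fin k)
  part A with encodes? A
  ... | yes (c , _) = just (place c)
  ... | no _        = nothing

  part-encode : ∀ c → part (encode c) ≡ just (place c)
  part-encode c with encodes? (encode c)
  ... | yes (c′ , c≡c′) = cong (just ∘ place) (sym (encode-injective c≡c′))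
  ... | no ∄c′          = contradiction (c , refl) ∄c′

  part⇒encode : ∀ {A u} → part A ≡ just u → ∃[ c ] A ≡ encode c × place c ≡ u
  part⇒encode {A} A↦u with encodes? A
  ... | yes (c , A≡c) = c , A≡c , just-injective A↦u

vertexOf : ∀ {m} → Subset (suc m) → Fin (suc (2 ^ m))
vertexOf (false ∷ bs) = inject₁ (index bs)
vertexOf (true  ∷ bs) = suc (index bs)

vertexOf-flip : ∀ {m} f f′ (bs : Subset m) →
  vertexOf (f ∷ bs) ≡ vertexOf (f′ ∷ bs) ⊎ Consecutive (vertexOf (f ∷ bs)) (vertexOf (f′ ∷ bs))
vertexOf-flip false false bs = inj₁ refl
vertexOf-flip false true  bs = inj₂ (inj₁ (cong suc (sym (toℕ-inject₁ (index bs)))))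
vertexOf-flip true  false bs = inj₂ (inj₂ (cong suc (sym (toℕ-inject₁ (index bs)))))
vertexOf-flip true  true  bs = inj₁ refl

vertexOf-surjective : ∀ {m} (v : Fin (suc (2 ^ m))) → Σ (Subset (suc m)) λ c → vertexOf c ≡ v
vertexOf-surjective {m} zero    =
  false ∷ ⊥ , toℕ-injective (trans (toℕ-inject₁ (index (⊥ {m}))) (toℕ-index-⊥ m))
vertexOf-surjective {m} (suc i) = true ∷ bits m i , cong suc (index-bits m i)

Consecutive⇒flagPair : ∀ {m} {u v : Fin (suc (2 ^ m))} → toℕ v ≡ suc (toℕ u) →
                        Σ (Subset m) λ bs → vertexOf (false ∷ bs) ≡ u × vertexOf (true ∷ bs) ≡ v
Consecutive⇒flagPair {m} {u} {suc i} v≡1+u =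
  bits m i ,
  toℕ-injective (trans (toℕ-inject₁ _) (trans (cong toℕ (index-bits m i)) (suc-injective v≡1+u))) ,
  cong suc (index-bits m i)

toℕ-vertexOf-false∷⊥ : ∀ m → toℕ (vertexOf (false ∷ ⊥ {m})) ≡ 0
toℕ-vertexOf-false∷⊥ m = trans (toℕ-inject₁ (index (⊥ {m}))) (toℕ-index-⊥ m)

toℕ-vertexOf-true∷∁⊥ : ∀ m → toℕ (vertexOf (true ∷ ∁ (⊥ {m}))) ≡ 2 ^ m
toℕ-vertexOf-true∷∁⊥ m =
  trans (cong (λ c → suc (toℕ (index c))) (map-replicate not false m)) (1+toℕ-index-⊤ m)

StrongSpindle : ℕ → ℕ → Set₁
StrongSpindle d L = Σ (Spindle d) λ G′ →
  Spindle.LengthAtLeast G′ L × SPG.StrongAdjacency (Spindle.G G′) × SPG.EndPointCount (Spindle.G G′)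

weakenLength : ∀ {d L L′} → L′ ≤ L → StrongSpindle d L → StrongSpindle d L′
weakenLength L′≤L (G′ , long , strong , endPoints) = G′ , (λ ℓ w → ≤-trans L′≤L (long ℓ w)) , strong , endPoints

module BlockSpindle (cs : List ℕ) (cs≥2 : All (2 ≤_) cs) where

  ks : List ℕ
  ks = 1 ∷ cs

  m : ℕ
  m = length cs

  open CodePartition (layout ks) (layout-injective (s≤s z≤n ∷ All.map <⇒≤ cs≥2)) vertexOf

  sameBits : ∀ f f′ bs bs′ → sum cs ≤ ∣ layout ks (f ∷ bs) ∩ layout ks (f′ ∷ bs′) ∣ → bs ≡ bs′
  sameBits f f′ bs bs′ h = sum≤1+agreement⇒≡ cs≥2 bs bs′ (begin
    sum cs                                        ≤⟨ h ⟩
    ∣ layout ks (f ∷ bs) ∩ layout ks (f′ ∷ bs′) ∣ ≡⟨ ∣layout∩layout∣≡agreement ks (f ∷ bs) (f′ ∷ bs′) ⟩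
    blockAgreement 1 f f′ + agreement cs bs bs′   ≤⟨ +-monoˡ-≤ _ (blockAgreement≤ 1 f f′) ⟩
    suc (agreement cs bs bs′)                     ∎)
    where open ≤-Reasoning

  size : ∀ A v → part A ≡ just v → ∣ A ∣ ≡ sum ks
  size A v A↦v with part⇒encode A↦v
  ... | c , refl , _ = ∣layout∣≡sum ks c

  nonempty : ∀ v → ∃[ A ] part A ≡ just v
  nonempty v = let (c , c↦v) = vertexOf-surjective v in layout ks c , trans (part-encode c) (cong just c↦v)

  G : SPG (sum ks + sum ks) (sum ks)
  G = record
    { k         = suc (2 ^ m)
    ; vtx       = part
    ; E         = Consecutive
    ; size      = size
    ; nonempty  = nonempty
    ; E-sym     = Consecutive-sym
    ; E-irr     = Consecutive-irrefl
    ; connected = Consecutive-connected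
    }

  adjacency : SPG.Adjacency G
  adjacency A A′ u u′ A↦u A′↦u′ ∣A∩A′∣ with part⇒encode A↦u | part⇒encode A′↦u′
  ... | f ∷ bs , refl , refl | f′ ∷ bs′ , refl , refl with sameBits f f′ bs bs′ (≤-reflexive (sym ∣A∩A′∣))
  ... | refl = vertexOf-flip f f′ bs

  flagPair : ∀ {u v} → toℕ v ≡ suc (toℕ u) →
             ∃[ A ] ∃[ A′ ] part A ≡ just u × part A′ ≡ just v × ∣ A ∩ A′ ∣ ≡ sum cs
  flagPair v≡1+u =
    let (bs , bs↦u , bs↦v) = Consecutive⇒flagPair v≡1+u in
    layout ks (false ∷ bs) , layout ks (true ∷ bs) ,
    trans (part-encode (false ∷ bs)) (cong just bs↦u) ,
    trans (part-encode (true ∷ bs)) (cong just bs↦v) ,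
    trans (∣layout∩layout∣≡agreement ks (false ∷ bs) (true ∷ bs)) (agreement-self cs bs)

  strongAdjacency : SPG.StrongAdjacency G
  strongAdjacency = adjacency , witnesses
    where
    witnesses : ∀ u u′ → Consecutive u u′ →
                ∃[ A ] ∃[ A′ ] part A ≡ just u × part A′ ≡ just u′ × ∣ A ∩ A′ ∣ ≡ sum cs
    witnesses u u′ (inj₁ u′≡1+u) = flagPair u′≡1+u
    witnesses u u′ (inj₂ u≡1+u′) =
      let (A , A′ , A↦u′ , A′↦u , ∣A∩A′∣) = flagPair u≡1+u′ in
      A′ , A , A′↦u , A↦u′ , trans (cong ∣_∣ (∩-comm A′ A)) ∣A∩A′∣

  endPointCount : SPG.EndPointCount G
  endPointCount F A₁ A₂ A₃ ∣F∣ (_ , A₁↦) (_ , A₂↦) (_ , A₃↦) F⊆A₁ F⊆A₂ F⊆A₃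
    with part⇒encode A₁↦ | part⇒encode A₂↦ | part⇒encode A₃↦
  ... | f₁ ∷ bs , refl , _ | f₂ ∷ bs₂ , refl , _ | f₃ ∷ bs₃ , refl , _
    with sameBits f₁ f₂ bs bs₂ (subst (_≤ _) ∣F∣ (∣p∣≤∣q∩r∣ F⊆A₁ F⊆A₂))
       | sameBits f₁ f₃ bs bs₃ (subst (_≤ _) ∣F∣ (∣p∣≤∣q∩r∣ F⊆A₁ F⊆A₃))
  ... | refl | refl =
    Sum.map (cong flagged) (Sum.map (cong flagged) (cong flagged)) (Bool-pigeonhole f₁ f₂ f₃)
    where
    flagged : Bool → Subset (sum ks + sum ks)
    flagged f = layout ks (f ∷ bs)

  spindle : StrongSpindle (sum ks) (2 ^ m)
  spindle = record
    { G     = G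
    ; A₁    = layout ks apex
    ; A₂    = layout ks (∁ apex)
    ; v₁    = vertexOf apex
    ; v₂    = vertexOf (∁ apex)
    ; A₁∈   = part-encode apex
    ; A₂∈   = part-encode (∁ apex)
    ; cover = layout∪layout-∁≡⊤ ks apex
    } , long , strongAdjacency , endPointCount
    where
    apex : Subset (suc m)
    apex = false ∷ ⊥
    long : ∀ ℓ → Walk Consecutive (vertexOf apex) (vertexOf (∁ apex)) ℓ → 2 ^ m ≤ ℓ
    long ℓ w = begin
      2 ^ m                   ≡⟨ toℕ-vertexOf-true∷∁⊥ m ⟨
      toℕ (vertexOf (∁ apex)) ≤⟨ toℕ-walk≤ w ⟩
      toℕ (vertexOf apex) + ℓ ≡⟨ cong (_+ ℓ) (toℕ-vertexOf-false∷⊥ m) ⟩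
      ℓ                       ∎
      where open ≤-Reasoning

nCk≤2^n : ∀ n k → n C k ≤ 2 ^ n
nCk≤2^n zero    zero    = ≤-refl
nCk≤2^n zero    (suc k) = z≤n
nCk≤2^n (suc n) zero    = m^n>0 2 (suc n)
nCk≤2^n (suc n) (suc k) = begin
  suc n C suc k       ≡⟨ nCk+nC[k+1]≡[n+1]C[k+1] n k ⟨
  n C k + n C suc k   ≤⟨ +-mono-≤ (nCk≤2^n n k) (nCk≤2^n n (suc k)) ⟩
  2 ^ n + 2 ^ n       ≡⟨ cong (2 ^ n +_) (+-identityʳ (2 ^ n)) ⟨
  2 ^ suc n           ∎
  where open ≤-Reasoning

pairs : ℕ → List ℕ
pairs zero    = []
pairs (suc d) = 43 ∷ 44 ∷ pairs d

pairs≥2 : ∀ d → All (2 ≤_) (pairs d)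
pairs≥2 zero    = []
pairs≥2 (suc d) = s≤s (s≤s z≤n) ∷ s≤s (s≤s z≤n) ∷ pairs≥2 d

sum-pairs : ∀ d → sum (pairs d) ≡ r * d
sum-pairs zero    = refl
sum-pairs (suc d) = trans (cong (r +_) (sum-pairs d)) (sym (*-suc r d))

length-pairs : ∀ d → length (pairs d) ≡ 2 * d
length-pairs zero    = refl
length-pairs (suc d) = trans (cong (2 +_) (length-pairs d)) (sym (*-suc 2 d))

-- The first pair is (43, 43) rather than (43, 44) to leave room for the flag block.
blockSizes : ℕ → List ℕ
blockSizes d = 43 ∷ 43 ∷ pairs d

blockSizes≥2 : ∀ d → All (2 ≤_) (blockSizes d)
blockSizes≥2 d = s≤s (s≤s z≤n) ∷ s≤s (s≤s z≤n) ∷ pairs≥2 d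

1+sum-blockSizes : ∀ d → 1 + sum (blockSizes d) ≡ r * suc d
1+sum-blockSizes d = sum-pairs (suc d)

length-blockSizes : ∀ d → length (blockSizes d) ≡ 2 * suc d
length-blockSizes d = length-pairs (suc d)

mainTheorem2 : (d : ℕ) → 1 ≤ d →
    Σ (Spindle (r * d)) λ G′ →
      Spindle.LengthAtLeast G′ (((2 * d) C d) ∸ 1)
      × SPG.StrongAdjacency (Spindle.G G′)
      × SPG.EndPointCount (Spindle.G G′)
mainTheorem2 zero    ()
mainTheorem2 (suc d) _ =
  subst (λ D → StrongSpindle D L) (1+sum-blockSizes d) (weakenLength L≤2^length spindle)
  where
  open BlockSpindle (blockSizes d) (blockSizes≥2 d) using (spindle)
  L = ((2 * suc d) C suc d) ∸ 1
  L≤2^length : L ≤ 2 ^ length (blockSizes d)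
  L≤2^length = begin
    L                         ≤⟨ m∸n≤m _ 1 ⟩
    (2 * suc d) C suc d       ≤⟨ nCk≤2^n (2 * suc d) (suc d) ⟩
    2 ^ (2 * suc d)           ≡⟨ cong (2 ^_) (length-blockSizes d) ⟨
    2 ^ length (blockSizes d) ∎
    where open ≤-Reasoning
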